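{- Let $W$ be a set of eight distinct MacMahon cubes with $\mathrm{Ba}\in W$ such that $G_W$ has seven edges. If $G_W$ is connected, then the solution number of $W$ for the target $\mathrm{Ba}$ is $8$.
   Context: A MacMahon cube is a cube whose six faces are painted with the colors $1,\dots,6$, each used once, up to rotation (there are $30$ of them). At each vertex three faces meet; reading their colors clockwise as seen from outside gives a cyclic triple, and the corner number of the vertex is the cyclic rotation of this triple of smallest three-digit value; each MacMahon cube has $8$ distinct corner numbers. $\mathrm{Ba}$ denotes the MacMahon cube whose corner numbers are $\{123,134,146,162,253,265,354,456\}$. Every MacMahon cube other than $\mathrm{Ba}$ shares either $0$ or exactly $2$ corner numbers with $\mathrm{Ba}$. $M$ is the multigraph whose vertex set is the $8$ corner numbers of $\mathrm{Ba}$, with one edge, labeled $C$, joining the two shared corner numbers for each MacMahon cube $C\neq\mathrm{Ba}$ sharing exactly two corner numbers with $\mathrm{Ba}$ ($20$ edges, no loops, some parallel pairs). For a set $W$ of MacMahon cubes, $G_W$ is the subgraph of $M$ with all $8$ vertices and exactly the edges labeled by cubes in $W$ (the cube $\mathrm{Ba}$ itself labels no edge). A solution for target $\mathrm{Ba}$ is a bijection $\sigma$ from $W$ to the corner numbers of $\mathrm{Ba}$ with $\sigma(C)$ a corner number of $C$ for all $C\in W$; the solution number is the number of such bijections. -}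

module Defs where

open import Data.Nat using (ℕ; zero; suc; _+_; _*_; _⊓_; _≡ᵇ_)
open import Data.Nat.Properties using (_≟_)
open import Data.Fin using (Fin; toℕ) renaming (zero to f0; suc to fs)
open import Data.Bool using (Bool; true; false; _∧_; if_then_else_)
open import Data.List using (List; []; _∷_; [_]; map; concatMap; length; filterᵇ; tabulate)
open import Data.List.Membership.Propositional using (_∈_)
open import Data.List.Membership.DecPropositional _≟_ using (_∈?_)
open import Data.Product using (Σ; _×_; _,_; ∃)
open import Data.Sum using (_⊎_)
open import Function using (id; _∘_)
open import Function.Definitions using (Injective)
open import Relation.Nullary using (¬_)
open import Relation.Nullary.Decidable using (isYes)
open import Relation.Binary.PropositionalEquality using (_≡_)
open import Relation.Binary.Construct.Closure.ReflexiveTransitive using (Star)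

-- Geometry of the cube.
-- Faces: 0 = +x, 1 = -x, 2 = +y, 3 = -y, 4 = +z, 5 = -z.

Face : Set
Face = Fin 6

pattern F0 = f0
pattern F1 = fs f0
pattern F2 = fs (fs f0)
pattern F3 = fs (fs (fs f0))
pattern F4 = fs (fs (fs (fs f0)))
pattern F5 = fs (fs (fs (fs (fs f0))))

record Coloring : Set where
  constructor mkColoring
  field
    col : Face → Fin 6
    inj : Injective _≡_ _≡_ col
open Coloring public

colour : Coloring → Face → ℕ
colour c f = suc (toℕ (col c f))

gz : Face → Face
gz F0 = F2
gz F2 = F1
gz F1 = F3
gz F3 = F0
gz F4 = F4
gz F5 = F5

gx : Face → Face
gx F2 = F4
gx F4 = F3
gx F3 = F5
gx F5 = F2
gx F0 = F0
gx F1 = F1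

data Rotation : (Face → Face) → Set where
  rid : Rotation id
  rz  : ∀ {ρ} → Rotation ρ → Rotation (ρ ∘ gz)
  rx  : ∀ {ρ} → Rotation ρ → Rotation (ρ ∘ gx)

_∼_ : Coloring → Coloring → Set
c ∼ d = Σ (Face → Face) λ ρ → Rotation ρ × (∀ f → colour d f ≡ colour c (ρ f))

-- MacMahon cubes are colourings up to ∼.
MacMahon : Set
MacMahon = Coloring

-- The 8 vertices, each listed as its three faces in clockwise order as
-- seen from outside. Vertex (sx,sy,sz) meets faces X_sx, Y_sy, Z_sz;
-- clockwise order is (x,z,y) if sx*sy*sz = +1, and (x,y,z) otherwise.
data Triple (A : Set) : Set where
  tri : A → A → A → Triple A

vertices : List (Triple Face)
vertices =
  tri F0 F4 F2 ∷ tri F0 F2 F5 ∷ tri F0 F3 F4 ∷ tri F0 F5 F3 ∷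
  tri F1 F2 F4 ∷ tri F1 F5 F2 ∷ tri F1 F4 F3 ∷ tri F1 F3 F5 ∷ []

val : ℕ → ℕ → ℕ → ℕ
val a b c = 100 * a + 10 * b + c

cornerNumber : ℕ → ℕ → ℕ → ℕ
cornerNumber a b c = val a b c ⊓ (val b c a ⊓ val c a b)

cornerNumbers : Coloring → List ℕ
cornerNumbers C = map corner vertices
  where
  corner : Triple Face → ℕ
  corner (tri f g h) = cornerNumber (colour C f) (colour C g) (colour C h)

baCorners : List ℕ
baCorners = 123 ∷ 134 ∷ 146 ∷ 162 ∷ 253 ∷ 265 ∷ 354 ∷ 456 ∷ []

IsBa : Coloring → Set
IsBa C = (∀ n → n ∈ cornerNumbers C → n ∈ baCorners)
       × (∀ n → n ∈ baCorners → n ∈ cornerNumbers C)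

shared : Coloring → List ℕ
shared C = filterᵇ (λ n → isYes (n ∈? cornerNumbers C)) baCorners

-- C labels an edge of M: C ≠ Ba shares exactly two corner numbers with Ba
-- (Ba itself shares 8, so "exactly two" already excludes Ba)
labelsEdge : Coloring → Bool
labelsEdge C = length (shared C) ≡ᵇ 2

edgeCount : (Fin 8 → Coloring) → ℕ
edgeCount W = length (filterᵇ (labelsEdge ∘ W) (tabulate id))

Adj : (Fin 8 → Coloring) → ℕ → ℕ → Set
Adj W u v = ∃ λ i → labelsEdge (W i) ≡ true
                  × (shared (W i) ≡ u ∷ v ∷ [] ⊎ shared (W i) ≡ v ∷ u ∷ [])

Connected : (Fin 8 → Coloring) → Set
Connected W = ∀ u v → u ∈ baCorners → v ∈ baCorners → Star (Adj W) u v

insertions : {A : Set} → A → List A → List (List A)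
insertions x [] = [ x ∷ [] ]
insertions x (y ∷ ys) = (x ∷ y ∷ ys) ∷ map (y ∷_) (insertions x ys)

perms : {A : Set} → List A → List (List A)
perms [] = [ [] ]
perms (x ∷ xs) = concatMap (insertions x) (perms xs)

fits : List Coloring → List ℕ → Bool
fits [] [] = true
fits (C ∷ Cs) (n ∷ ns) = isYes (n ∈? cornerNumbers C) ∧ fits Cs ns
fits _ _ = false

-- A bijection σ : W → corners(Ba) is the same as an ordering
-- (σ(W 0), …, σ(W 7)) of the (distinct) corner numbers of Ba.
-- The solution number counts those with σ(C) a corner number of C.
solutionNumber : (Fin 8 → Coloring) → ℕ
solutionNumber W = length (filterᵇ (fits (tabulate W)) (perms baCorners))

-- Whether a bijection is a solution depends only on which of Ba's corner numbers each cube
-- has, i.e. on the rows `shared C`: all eight corners for Ba, and the two ends of its edge for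
-- a cube labelling an edge of M.  So the solution number is the permanent of the 0/1 matrix of
-- these rows, which does not change when the rows are permuted.  Running through all 720
-- colourings shows that the 20 edges of M join only 16 pairs of corners.  If G_W is connected,
-- its seven edges are distinct pairs forming a spanning tree, and then the permanent is 8: Ba
-- can take any corner, after which every edge is forced onto its endpoint away from Ba.
-- Instead of proving this for trees in general, every set of at most seven of the 16 pairs is
-- checked to be either cut by a set of corners or a spanning tree with permanent 8.

{-# OPTIONS --safe #-}
module Submission where

open import Defs
open import Data.Nat using (ℕ)
open import Data.Fin using (Fin)
open import Data.Product using (Σ; ∃; _×_)
open import Relation.Nullary using (¬_)
open import Relation.Binary.PropositionalEquality using (_≡_; _≢_)

open import Data.Bool using (Bool; true; false; T; T?; not; _∧_; _∨_; if_then_else_)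
open import Data.Bool.ListAction using (all; any)
open import Data.Bool.Properties using (T-∧; T-∨; T-≡; T-not-≡; if-∧; if-eta; ∧-conicalˡ; ∧-conicalʳ)
open import Data.Empty using (⊥; ⊥-elim)
open import Data.Fin using (zero; suc; toℕ; punchIn)
import Data.Fin.Properties as Fin
open import Data.List using (List; []; _∷_; _++_; map; foldr; length; filterᵇ; concatMap; null; tabulate; allFin)
open import Data.List.Properties
  using (filter-++; length-++; filter-≐; filter-all; filter-complete; length-map; length-tabulate; map-tabulate; ≡-dec)
open import Data.List.Membership.Propositional using (_∈_; _∉_)
open import Data.List.Membership.Propositional.Properties
  using (∈-allFin; ∈-∃++; ∈-filter⁺; ∈-filter⁻; ∈-map⁺; ∈-map⁻; ∈-tabulate⁺)
import Data.List.Membership.DecPropositional as DecMembership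
open import Data.List.Relation.Binary.Permutation.Propositional using (_↭_; refl; prep; swap; trans; ↭-sym)
open import Data.List.Relation.Binary.Permutation.Propositional.Properties
  using (↭-length; ∈-resp-↭; shift; map⁺; filter-↭)
open import Data.List.Relation.Binary.Subset.Propositional using (_⊆_)
open import Data.List.Relation.Binary.Sublist.Propositional using ([]; _∷_; _∷ʳ_) renaming (_⊆_ to _⊑_)
open import Data.List.Relation.Binary.Sublist.Propositional.Properties using (filter-⊆)
open import Data.List.Relation.Unary.All using (All; []; _∷_; lookup)
import Data.List.Relation.Unary.All as All
open import Data.List.Relation.Unary.All.Properties using (all⁺; all⁻; all-filter)
open import Data.List.Relation.Unary.Any using (here; there)
open import Data.List.Relation.Unary.Unique.Propositional using (Unique; _∷_)
import Data.List.Relation.Unary.Unique.Propositional.Properties as Unique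
open import Data.Nat using (zero; suc; _+_; _≤_; z≤n; s≤s; s≤s⁻¹; _≡ᵇ_)
open import Data.Nat.GeneralisedArithmetic using (iterate)
open import Data.Nat.Properties using (_≟_; ≤-reflexive; <⇒≱; ≡ᵇ⇒≡; ≡⇒≡ᵇ; +-commutativeSemigroup)
open import Algebra.Properties.CommutativeSemigroup +-commutativeSemigroup using (interchange; x∙yz≈y∙xz)
open import Data.List.Relation.Unary.Unique.DecPropositional (≡-dec _≟_) using (unique?)
open DecMembership _≟_ using (_∈?_)
open DecMembership (≡-dec _≟_) using () renaming (_∈?_ to _∈ᴸ?_)
open import Data.Product using (_,_; proj₁; proj₂)
open import Data.Sum using (_⊎_; inj₁; inj₂; [_,_]′)
open import Data.Unit using (tt)
open import Data.Vec using (Vec; []; _∷_)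
import Data.Vec as Vec
open import Function using (_∘_; id; Injective; Equivalence)
open import Relation.Binary.Construct.Closure.ReflexiveTransitive using (Star; ε; _◅_)
open import Relation.Binary.Definitions using (DecidableEquality)
open import Relation.Binary.PropositionalEquality using (refl; sym; cong; cong₂; subst; module ≡-Reasoning)
  renaming (trans to ≡-trans)
open import Relation.Nullary using (contradiction)
open import Relation.Nullary.Decidable using (isYes; toWitness; fromWitness)

indicator : Bool → ℕ
indicator b = if b then 1 else 0

if-+ : ∀ b m n → (if b then m + n else 0) ≡ (if b then m else 0) + (if b then n else 0)
if-+ true  m n = refl
if-+ false m n = refl

count : {A : Set} → (A → Bool) → List A → ℕ
count p xs = length (filterᵇ p xs)

module _ {A : Set} where

  count-∷ : (p : A → Bool) → ∀ x xs → count p (x ∷ xs) ≡ indicator (p x) + count p xs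
  count-∷ p x xs with p x
  ... | true  = refl
  ... | false = refl

  count-++ : (p : A → Bool) → ∀ xs ys → count p (xs ++ ys) ≡ count p xs + count p ys
  count-++ p xs ys = ≡-trans (cong length (filter-++ _ xs ys)) (length-++ (filterᵇ p xs))

  count-false : (xs : List A) → count (λ _ → false) xs ≡ 0
  count-false []       = refl
  count-false (x ∷ xs) = count-false xs

  count-↭ : (p : A → Bool) → ∀ {xs ys} → xs ↭ ys → count p xs ≡ count p ys
  count-↭ p xs↭ys = ↭-length (filter-↭ _ xs↭ys)

  count-cong : ∀ {p q : A → Bool} → (∀ x → p x ≡ q x) → ∀ xs → count p xs ≡ count q xs
  count-cong p≗q xs = cong length (filter-≐ _ _ ((λ {x} → subst T (p≗q x)) , (λ {x} → subst T (sym (p≗q x)))) xs)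

  count≡length⇒All : (p : A → Bool) → ∀ xs → count p xs ≡ length xs → All (λ x → p x ≡ true) xs
  count≡length⇒All p xs eq = All.map (Equivalence.to T-≡) (subst (All (T ∘ p)) (filter-complete _ eq) (all-filter _ xs))

count-map : {A B : Set} (p : B → Bool) (f : A → B) → ∀ xs → count p (map f xs) ≡ count (p ∘ f) xs
count-map p f []       = refl
count-map p f (x ∷ xs) with p (f x)
... | true  = cong suc (count-map p f xs)
... | false = count-map p f xs

count-tabulate : {A : Set} {n : ℕ} (p : A → Bool) (f : Fin n → A) → count p (tabulate f) ≡ count (p ∘ f) (allFin n)
count-tabulate {n = n} p f = ≡-trans (cong (count p) (sym (map-tabulate id f))) (count-map p f (allFin n))

-- Permanents

module _ {R : Set} where

  sumOverPicks : (R → List R → ℕ) → List R → ℕ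
  sumOverPicks f []       = 0
  sumOverPicks f (r ∷ rs) = f r rs + sumOverPicks (λ s rest → f s (r ∷ rest)) rs

  sumOverPicks-cong : ∀ {f g} → (∀ r rest → f r rest ≡ g r rest) → ∀ rs → sumOverPicks f rs ≡ sumOverPicks g rs
  sumOverPicks-cong f≗g []       = refl
  sumOverPicks-cong f≗g (r ∷ rs) = cong₂ _+_ (f≗g r rs) (sumOverPicks-cong (λ s rest → f≗g s (r ∷ rest)) rs)

  sumOverPicks-zero : ∀ {f} → (∀ r rest → f r rest ≡ 0) → ∀ rs → sumOverPicks f rs ≡ 0
  sumOverPicks-zero f≗0 []       = refl
  sumOverPicks-zero f≗0 (r ∷ rs) = cong₂ _+_ (f≗0 r rs) (sumOverPicks-zero (λ s rest → f≗0 s (r ∷ rest)) rs)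

  sumOverPicks-+ : ∀ f g rs → sumOverPicks (λ r rest → f r rest + g r rest) rs ≡ sumOverPicks f rs + sumOverPicks g rs
  sumOverPicks-+ f g []       = refl
  sumOverPicks-+ f g (r ∷ rs) =
    ≡-trans (cong (f r rs + g r rs +_) (sumOverPicks-+ (λ s rest → f s (r ∷ rest)) (λ s rest → g s (r ∷ rest)) rs))
            (interchange (f r rs) (g r rs) _ _)

  sumOverPicks-↭ : ∀ f → (∀ r {rest rest′} → rest ↭ rest′ → f r rest ≡ f r rest′) →
                   ∀ {rs rs′} → rs ↭ rs′ → sumOverPicks f rs ≡ sumOverPicks f rs′
  sumOverPicks-↭ f f-↭ refl        = refl
  sumOverPicks-↭ f f-↭ (prep r p)  = cong₂ _+_ (f-↭ r p) (sumOverPicks-↭ _ (λ s q → f-↭ s (prep r q)) p)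
  sumOverPicks-↭ f f-↭ (trans p q) = ≡-trans (sumOverPicks-↭ f f-↭ p) (sumOverPicks-↭ f f-↭ q)
  sumOverPicks-↭ f f-↭ {r ∷ s ∷ rs} {.s ∷ .r ∷ rs′} (swap .r .s p) =
    ≡-trans (x∙yz≈y∙xz (f r (s ∷ rs)) (f s (r ∷ rs)) _)
            (cong₂ _+_ (f-↭ s (prep r p)) (cong₂ _+_ (f-↭ r (prep s p)) rest≡))
    where
    rest≡ : sumOverPicks (λ t rest → f t (r ∷ s ∷ rest)) rs ≡ sumOverPicks (λ t rest → f t (s ∷ r ∷ rest)) rs′
    rest≡ = ≡-trans (sumOverPicks-↭ _ (λ t q → f-↭ t (prep r (prep s q))) p)
                    (sumOverPicks-cong (λ t rest → f-↭ t (swap r s refl)) rs′)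

sumOverPicks-map : {R R′ : Set} (f : R′ → List R′ → ℕ) (g : R → R′) → ∀ rs →
                   sumOverPicks f (map g rs) ≡ sumOverPicks (λ r rest → f (g r) (map g rest)) rs
sumOverPicks-map f g []       = refl
sumOverPicks-map f g (r ∷ rs) = cong (f (g r) (map g rs) +_) (sumOverPicks-map (λ s rest → f s (g r ∷ rest)) g rs)

null-↭ : {A : Set} {xs ys : List A} → xs ↭ ys → null xs ≡ null ys
null-↭ {xs = []}    {[]}    p = refl
null-↭ {xs = _ ∷ _} {_ ∷ _} p = refl
null-↭ {xs = []}    {_ ∷ _} p with () ← ↭-length p
null-↭ {xs = _ ∷ _} {[]}    p with () ← ↭-length p

module Matching {R X : Set} (_∋_ : R → X → Bool) where

  Fits : List R → List X → Bool
  Fits []       []       = true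
  Fits (r ∷ rs) (x ∷ xs) = r ∋ x ∧ Fits rs xs
  Fits _        _        = false

  matchings : List R → List X → ℕ
  matchings rs []       = indicator (null rs)
  matchings rs (x ∷ xs) = sumOverPicks (λ r rest → if r ∋ x then matchings rest xs else 0) rs

  count-Fits-insertions : ∀ rs x q →
    count (Fits rs) (insertions x q) ≡ sumOverPicks (λ r rest → if r ∋ x then indicator (Fits rest q) else 0) rs
  count-Fits-insertions []       x []       = refl
  count-Fits-insertions []       x (y ∷ q)  =
    ≡-trans (count-map (Fits []) (y ∷_) (insertions x q)) (count-false (insertions x q))
  count-Fits-insertions (r ∷ rs) x []       = begin
    count (Fits (r ∷ rs)) ((x ∷ []) ∷ [])
      ≡⟨ count-∷ (Fits (r ∷ rs)) (x ∷ []) [] ⟩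
    indicator (r ∋ x ∧ Fits rs []) + 0
      ≡⟨ cong₂ _+_ (if-∧ (r ∋ x)) (sym (sumOverPicks-zero (λ s _ → if-eta (s ∋ x)) rs)) ⟩
    (if r ∋ x then indicator (Fits rs []) else 0) + sumOverPicks (λ s rest → if s ∋ x then 0 else 0) rs  ∎
    where open ≡-Reasoning
  count-Fits-insertions (r ∷ rs) x (y ∷ q)  = begin
    count (Fits (r ∷ rs)) ((x ∷ y ∷ q) ∷ map (y ∷_) (insertions x q))
      ≡⟨ count-∷ (Fits (r ∷ rs)) (x ∷ y ∷ q) _ ⟩
    indicator (r ∋ x ∧ Fits rs (y ∷ q)) + count (Fits (r ∷ rs)) (map (y ∷_) (insertions x q))
      ≡⟨ cong₂ _+_ (if-∧ (r ∋ x)) (≡-trans (count-map (Fits (r ∷ rs)) (y ∷_) (insertions x q)) later) ⟩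
    (if r ∋ x then indicator (Fits rs (y ∷ q)) else 0)
      + sumOverPicks (λ s rest → if s ∋ x then indicator (r ∋ y ∧ Fits rest q) else 0) rs  ∎
    where
    open ≡-Reasoning
    later : count (λ l → r ∋ y ∧ Fits rs l) (insertions x q)
          ≡ sumOverPicks (λ s rest → if s ∋ x then indicator (r ∋ y ∧ Fits rest q) else 0) rs
    later with r ∋ y
    ... | true  = count-Fits-insertions rs x q
    ... | false = ≡-trans (count-false (insertions x q)) (sym (sumOverPicks-zero (λ s _ → if-eta (s ∋ x)) rs))

  count-Fits-concatMap-insertions : ∀ rs x ps →
    count (Fits rs) (concatMap (insertions x) ps) ≡ sumOverPicks (λ r rest → if r ∋ x then count (Fits rest) ps else 0) rs
  count-Fits-concatMap-insertions rs x []       = sym (sumOverPicks-zero (λ r _ → if-eta (r ∋ x)) rs)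
  count-Fits-concatMap-insertions rs x (q ∷ ps) = begin
    count (Fits rs) (insertions x q ++ concatMap (insertions x) ps)
      ≡⟨ count-++ (Fits rs) (insertions x q) _ ⟩
    count (Fits rs) (insertions x q) + count (Fits rs) (concatMap (insertions x) ps)
      ≡⟨ cong₂ _+_ (count-Fits-insertions rs x q) (count-Fits-concatMap-insertions rs x ps) ⟩
    sumOverPicks (λ r rest → if r ∋ x then indicator (Fits rest q) else 0) rs
      + sumOverPicks (λ r rest → if r ∋ x then count (Fits rest) ps else 0) rs
      ≡⟨ sym (sumOverPicks-+ _ _ rs) ⟩
    sumOverPicks (λ r rest → (if r ∋ x then indicator (Fits rest q) else 0)
                             + (if r ∋ x then count (Fits rest) ps else 0)) rs
      ≡⟨ sumOverPicks-cong (λ r rest → ≡-trans (sym (if-+ (r ∋ x) _ _))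
                                               (cong (if r ∋ x then_else 0) (sym (count-∷ (Fits rest) q ps)))) rs ⟩
    sumOverPicks (λ r rest → if r ∋ x then count (Fits rest) (q ∷ ps) else 0) rs  ∎
    where open ≡-Reasoning

  count-Fits-perms : ∀ rs xs → count (Fits rs) (perms xs) ≡ matchings rs xs
  count-Fits-perms []      []       = refl
  count-Fits-perms (_ ∷ _) []       = refl
  count-Fits-perms rs      (x ∷ xs) =
    ≡-trans (count-Fits-concatMap-insertions rs x (perms xs))
            (sumOverPicks-cong (λ r rest → cong (if r ∋ x then_else 0) (count-Fits-perms rest xs)) rs)

  matchings-↭ : ∀ xs {rs rs′} → rs ↭ rs′ → matchings rs xs ≡ matchings rs′ xs
  matchings-↭ []       p = cong indicator (null-↭ p)
  matchings-↭ (x ∷ xs) p = sumOverPicks-↭ _ (λ r q → cong (if r ∋ x then_else 0) (matchings-↭ xs q)) p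

matchings-map : {R R′ X : Set} (_∋_ : R → X → Bool) (_∋′_ : R′ → X → Bool) (f : R → R′) →
                ∀ rs xs → All (λ x → ∀ r → r ∋ x ≡ f r ∋′ x) xs →
                Matching.matchings _∋_ rs xs ≡ Matching.matchings _∋′_ (map f rs) xs
matchings-map _∋_ _∋′_ f []      []       [] = refl
matchings-map _∋_ _∋′_ f (_ ∷ _) []       [] = refl
matchings-map _∋_ _∋′_ f rs      (x ∷ xs) (x-agrees ∷ xs-agree) =
  sym (≡-trans (sumOverPicks-map _ f rs)
               (sumOverPicks-cong (λ r rest → sym (cong₂ (λ b n → if b then n else 0)
                                                         (x-agrees r) (matchings-map _∋_ _∋′_ f rest xs xs-agree))) rs))

tabulate-↭ : {A : Set} {n : ℕ} (f : Fin (suc n) → A) (i : Fin (suc n)) →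
             tabulate f ↭ f i ∷ tabulate (f ∘ punchIn i)
tabulate-↭             f zero    = refl
tabulate-↭ {n = suc n} f (suc i) = trans (prep (f zero) (tabulate-↭ (f ∘ suc) i)) (swap (f zero) (f (suc i)) refl)

map-tabulate-↭ : {A B : Set} {n : ℕ} (g : A → B) (f : Fin (suc n) → A) (i : Fin (suc n)) →
                 map g (tabulate f) ↭ g (f i) ∷ map g (tabulate (f ∘ punchIn i))
map-tabulate-↭ g f i = map⁺ g (tabulate-↭ f i)

module _ {A : Set} {n : ℕ} (p : A → Bool) (f : Fin (suc n) → A) (i : Fin (suc n)) (pfi≡false : p (f i) ≡ false) where

  All-tabulate-punchIn : count p (tabulate f) ≡ n → All (λ x → p x ≡ true) (tabulate (f ∘ punchIn i))
  All-tabulate-punchIn count≡n = count≡length⇒All p _ (begin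
    count p rest                       ≡⟨ cong (λ b → indicator b + count p rest) (sym pfi≡false) ⟩
    indicator (p (f i)) + count p rest ≡⟨ sym (count-∷ p (f i) rest) ⟩
    count p (f i ∷ rest)               ≡⟨ sym (count-↭ p (tabulate-↭ f i)) ⟩
    count p (tabulate f)               ≡⟨ count≡n ⟩
    n                                  ≡⟨ sym (length-tabulate (f ∘ punchIn i)) ⟩
    length rest                        ∎)
    where
    rest : List A
    rest = tabulate (f ∘ punchIn i)
    open ≡-Reasoning

  ∈-tabulate-punchIn : ∀ {j} → p (f j) ≡ true → f j ∈ tabulate (f ∘ punchIn i)
  ∈-tabulate-punchIn {j} pfj≡true with ∈-resp-↭ (tabulate-↭ f i) (∈-tabulate⁺ {f = f} j)
  ... | here fj≡fi = contradiction (≡-trans (sym pfj≡true) (≡-trans (cong p fj≡fi) pfi≡false)) λ ()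
  ... | there fj∈  = fj∈

map-⊆ : {A B : Set} (f : A → B) {xs : List A} {ys : List B} → (∀ {x} → x ∈ xs → f x ∈ ys) → map f xs ⊆ ys
map-⊆ f f∈ys y∈map with x , x∈xs , refl ← ∈-map⁻ f y∈map = f∈ys x∈xs

module _ {A : Set} where

  ∈⇒↭∷ : ∀ {x : A} {ys} → x ∈ ys → ∃ λ ys′ → ys ↭ x ∷ ys′
  ∈⇒↭∷ x∈ys with as , bs , refl ← ∈-∃++ x∈ys = as ++ bs , shift _ as bs

  ∈-↭∷⁻ : ∀ {x z : A} {ys ys′} → ys ↭ x ∷ ys′ → z ∈ ys → z ≢ x → z ∈ ys′
  ∈-↭∷⁻ ys↭ z∈ys z≢x with ∈-resp-↭ ys↭ z∈ys
  ... | here z≡x    = contradiction z≡x z≢x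
  ... | there z∈ys′ = z∈ys′

  Unique-⊆⇒length≤ : ∀ {xs ys : List A} → Unique xs → xs ⊆ ys → length xs ≤ length ys
  Unique-⊆⇒length≤ {[]}     _            _     = z≤n
  Unique-⊆⇒length≤ {x ∷ xs} (x≢xs ∷ xs!) xs⊆ys with ys′ , ys↭ ← ∈⇒↭∷ (xs⊆ys (here refl)) =
    subst (suc (length xs) ≤_) (sym (↭-length ys↭)) (s≤s (Unique-⊆⇒length≤ xs! xs⊆ys′))
    where
    xs⊆ys′ : xs ⊆ ys′
    xs⊆ys′ z∈xs = ∈-↭∷⁻ ys↭ (xs⊆ys (there z∈xs)) (λ z≡x → lookup x≢xs z∈xs (sym z≡x))

  Unique-⊆-⊇⇒↭ : ∀ {xs ys : List A} → Unique ys → xs ⊆ ys → ys ⊆ xs → length xs ≤ length ys → xs ↭ ys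
  Unique-⊆-⊇⇒↭ {[]}    {[]}     _ _     _ _ = refl
  Unique-⊆-⊇⇒↭ {_ ∷ _} {[]}     _ xs⊆ys _ _ with () ← xs⊆ys (here refl)
  Unique-⊆-⊇⇒↭ {xs}    {y ∷ ys} (y≢ys ∷ ys!) xs⊆ys ys⊆xs xs≤ys
    with xs′ , xs↭ ← ∈⇒↭∷ (ys⊆xs (here refl)) =
    trans xs↭ (prep y (Unique-⊆-⊇⇒↭ ys! xs′⊆ys ys⊆xs′ xs′≤ys))
    where
    ys⊆xs′ : ys ⊆ xs′
    ys⊆xs′ z∈ys = ∈-↭∷⁻ xs↭ (ys⊆xs (there z∈ys)) (λ z≡y → lookup y≢ys z∈ys (sym z≡y))
    xs′≤ys : length xs′ ≤ length ys
    xs′≤ys = s≤s⁻¹ (subst (_≤ suc (length ys)) (↭-length xs↭) xs≤ys)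
    y∉xs′ : y ∉ xs′
    y∉xs′ y∈xs′ = <⇒≱ (Unique-⊆⇒length≤ (y≢ys ∷ ys!) y∷ys⊆xs′) xs′≤ys
      where
      y∷ys⊆xs′ : y ∷ ys ⊆ xs′
      y∷ys⊆xs′ (here refl)  = y∈xs′
      y∷ys⊆xs′ (there z∈ys) = ys⊆xs′ z∈ys
    xs′⊆ys : xs′ ⊆ ys
    xs′⊆ys z∈xs′ with xs⊆ys (∈-resp-↭ (↭-sym xs↭) (there z∈xs′))
    ... | here refl  = contradiction z∈xs′ y∉xs′
    ... | there z∈ys = z∈ys

module Intersection {A : Set} (_≟ᴬ_ : DecidableEquality A) where
  open DecMembership _≟ᴬ_ using () renaming (_∈?_ to _∈ᴬ?_)

  _∩_ : List A → List A → List A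
  xs ∩ ys = filterᵇ (λ x → isYes (x ∈ᴬ? ys)) xs

  ∈-∩⁺ : ∀ {x xs ys} → x ∈ xs → x ∈ ys → x ∈ xs ∩ ys
  ∈-∩⁺ x∈xs x∈ys = ∈-filter⁺ _ x∈xs (fromWitness x∈ys)

  ∈-∩⁻ : ∀ {x} xs {ys} → x ∈ xs ∩ ys → x ∈ ys
  ∈-∩⁻ xs x∈∩ = toWitness (proj₂ (∈-filter⁻ _ {xs = xs} x∈∩))

  ∩-⊑ : ∀ xs ys → xs ∩ ys ⊑ xs
  ∩-⊑ xs ys = filter-⊆ _ xs

  ∩-unique : ∀ {xs} ys → Unique xs → Unique (xs ∩ ys)
  ∩-unique ys = Unique.filter⁺ _

everySublist : {A : Set} → ℕ → List A → (List A → Bool) → Bool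
everySublist k       []       p = p []
everySublist zero    (x ∷ xs) p = p []
everySublist (suc k) (x ∷ xs) p = everySublist (suc k) xs p ∧ everySublist k xs (p ∘ (x ∷_))

everySublist-sound : {A : Set} → ∀ k (xs : List A) p → everySublist k xs p ≡ true →
                     ∀ {ys} → ys ⊑ xs → length ys ≤ k → p ys ≡ true
everySublist-sound k       []       p checked []           _          = checked
everySublist-sound zero    (x ∷ xs) p checked {[]}    _    _          = checked
everySublist-sound (suc k) (x ∷ xs) p checked (.x ∷ʳ ys⊑) ys≤k       =
  everySublist-sound (suc k) xs p (∧-conicalˡ _ (everySublist k xs (p ∘ (x ∷_))) checked) ys⊑ ys≤k
everySublist-sound (suc k) (x ∷ xs) p checked (refl ∷ ys⊑) (s≤s ys≤k) =
  everySublist-sound k xs (p ∘ (x ∷_)) (∧-conicalʳ (everySublist (suc k) xs p) _ checked) ys⊑ ys≤k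

module _ {A : Set} (_≟ᴬ_ : DecidableEquality A) (elements : List A) where
  open DecMembership _≟ᴬ_ using () renaming (_∈?_ to _∈ᴬ?_)

  everyInjection : ∀ k → List A → (Vec A k → Bool) → Bool
  everyInjection zero    used p = p []
  everyInjection (suc k) used p =
    all (λ a → isYes (a ∈ᴬ? used) ∨ everyInjection k (a ∷ used) (p ∘ (a ∷_))) elements

  everyInjection-sound : (∀ a → a ∈ elements) → ∀ k used p → everyInjection k used p ≡ true →
                         (g : Fin k → A) → Injective _≡_ _≡_ g → (∀ i → g i ∉ used) → p (Vec.tabulate g) ≡ true
  everyInjection-sound complete zero    used p checked g _     _       = checked
  everyInjection-sound complete (suc k) used p checked g g-inj g∉used =
    everyInjection-sound complete k (g zero ∷ used) (p ∘ (g zero ∷_)) checked′ (g ∘ suc) (Fin.suc-injective ∘ g-inj) fresh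
    where
    checked′ : everyInjection k (g zero ∷ used) (p ∘ (g zero ∷_)) ≡ true
    checked′ with Equivalence.to T-∨ (lookup (all⁺ _ elements (Equivalence.from T-≡ checked)) (complete (g zero)))
    ... | inj₁ g₀∈used = contradiction (toWitness g₀∈used) (g∉used zero)
    ... | inj₂ t       = Equivalence.to T-≡ t
    fresh : ∀ i → g (suc i) ∉ g zero ∷ used
    fresh i (here eq)  with () ← g-inj eq
    fresh i (there g∈) = g∉used (suc i) g∈

_∈ᵇ_ : ℕ → List ℕ → Bool
n ∈ᵇ []       = false
n ∈ᵇ (m ∷ ms) = (n ≡ᵇ m) ∨ (n ∈ᵇ ms)

∈ᵇ⇒∈ : ∀ {n} ms → T (n ∈ᵇ ms) → n ∈ ms
∈ᵇ⇒∈ {n} (m ∷ ms) n∈ᵇ with Equivalence.to (T-∨ {n ≡ᵇ m}) n∈ᵇ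
... | inj₁ n≡m  = here (≡ᵇ⇒≡ n m n≡m)
... | inj₂ n∈ms = there (∈ᵇ⇒∈ ms n∈ms)

∈⇒∈ᵇ : ∀ {n ms} → n ∈ ms → T (n ∈ᵇ ms)
∈⇒∈ᵇ {n} (here refl)           = Equivalence.from T-∨ (inj₁ (≡⇒≡ᵇ n n refl))
∈⇒∈ᵇ {n} {m ∷ _} (there n∈ms) = Equivalence.from (T-∨ {n ≡ᵇ m}) (inj₂ (∈⇒∈ᵇ n∈ms))

∈ᵇ-filterᵇ : (p : ℕ → Bool) → ∀ {n xs} → n ∈ xs → n ∈ᵇ filterᵇ p xs ≡ p n
∈ᵇ-filterᵇ p {n} {xs} n∈xs with n ∈ᵇ filterᵇ p xs in mem | p n in pn
... | true  | true  = refl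
... | false | false = refl
... | true  | false = ⊥-elim (subst T pn (proj₂ (∈-filter⁻ (T? ∘ p) {xs = xs} (∈ᵇ⇒∈ _ (subst T (sym mem) tt)))))
... | false | true  = ⊥-elim (subst T mem (∈⇒∈ᵇ (∈-filter⁺ (T? ∘ p) n∈xs (subst T (sym pn) tt))))

module ByCube    = Matching (λ (C : Coloring) n → isYes (n ∈? cornerNumbers C))
module ByCorners = Matching (λ r n → n ∈ᵇ r)

fits≡Fits : ∀ Cs ns → fits Cs ns ≡ ByCube.Fits Cs ns
fits≡Fits []       []       = refl
fits≡Fits []       (_ ∷ _)  = refl
fits≡Fits (_ ∷ _)  []       = refl
fits≡Fits (C ∷ Cs) (n ∷ ns) = cong (isYes (n ∈? cornerNumbers C) ∧_) (fits≡Fits Cs ns)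

count-fits-perms : ∀ Cs ns → All (_∈ baCorners) ns →
                   count (fits Cs) (perms ns) ≡ ByCorners.matchings (map shared Cs) ns
count-fits-perms Cs ns ns⊆ba = begin
  count (fits Cs) (perms ns)
    ≡⟨ count-cong (fits≡Fits Cs) (perms ns) ⟩
  count (ByCube.Fits Cs) (perms ns)
    ≡⟨ ByCube.count-Fits-perms Cs ns ⟩
  ByCube.matchings Cs ns
    ≡⟨ matchings-map (λ C n → isYes (n ∈? cornerNumbers C)) (λ r n → n ∈ᵇ r) shared Cs ns (All.map shared-∈ᵇ ns⊆ba) ⟩
  ByCorners.matchings (map shared Cs) ns ∎
  where
  open ≡-Reasoning
  shared-∈ᵇ : ∀ {n} → n ∈ baCorners → ∀ C → isYes (n ∈? cornerNumbers C) ≡ n ∈ᵇ shared C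
  shared-∈ᵇ n∈ba C = sym (∈ᵇ-filterᵇ (λ n → isYes (n ∈? cornerNumbers C)) n∈ba)

solutionNumber≡matchings : ∀ W → solutionNumber W ≡ ByCorners.matchings (map shared (tabulate W)) baCorners
solutionNumber≡matchings W = count-fits-perms (tabulate W) baCorners (All.tabulate id)

IsBa⇒shared≡baCorners : ∀ C → IsBa C → shared C ≡ baCorners
IsBa⇒shared≡baCorners C (_ , ba⊆C) =
  filter-all (T? ∘ (λ n → isYes (n ∈? cornerNumbers C))) (All.tabulate (λ {n} n∈ba → fromWitness (ba⊆C n n∈ba)))

IsBa⇒¬labelsEdge : ∀ C → IsBa C → labelsEdge C ≡ false
IsBa⇒¬labelsEdge C isBa = cong (λ s → length s ≡ᵇ 2) (IsBa⇒shared≡baCorners C isBa)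

cornersOf : Vec (Fin 6) 6 → List ℕ
cornersOf v = map corner vertices
  where
  colourOf : Face → ℕ
  colourOf f = suc (toℕ (Vec.lookup v f))
  corner : Triple Face → ℕ
  corner (tri f g h) = cornerNumber (colourOf f) (colourOf g) (colourOf h)

sharedWith : List ℕ → List ℕ
sharedWith cs = filterᵇ (λ n → isYes (n ∈? cs)) baCorners

cornersOf-col : ∀ C → cornersOf (Vec.tabulate (col C)) ≡ cornerNumbers C
cornersOf-col C = refl

sharedWith-cornersOf : ∀ C → sharedWith (cornersOf (Vec.tabulate (col C))) ≡ shared C
sharedWith-cornersOf C = cong sharedWith (cornersOf-col C)

pairsOfM : List (List ℕ)
pairsOfM =
  (123 ∷ 134 ∷ []) ∷ (123 ∷ 162 ∷ []) ∷ (123 ∷ 253 ∷ []) ∷ (123 ∷ 456 ∷ []) ∷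
  (134 ∷ 146 ∷ []) ∷ (134 ∷ 265 ∷ []) ∷ (134 ∷ 354 ∷ []) ∷ (146 ∷ 162 ∷ []) ∷
  (146 ∷ 253 ∷ []) ∷ (146 ∷ 456 ∷ []) ∷ (162 ∷ 265 ∷ []) ∷ (162 ∷ 354 ∷ []) ∷
  (253 ∷ 265 ∷ []) ∷ (253 ∷ 354 ∷ []) ∷ (265 ∷ 456 ∷ []) ∷ (354 ∷ 456 ∷ []) ∷ []

pairsOfM-unique : Unique pairsOfM
pairsOfM-unique = toWitness {a? = unique? pairsOfM} tt

isPairOfMIfEdge : List ℕ → Bool
isPairOfMIfEdge s = not (length s ≡ᵇ 2) ∨ isYes (s ∈ᴸ? pairsOfM)

-- Checks are stated with _≡ true rather than T, and facts about particular cubes come from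
-- lemmas about arbitrary ones: the type checker reduces types that differ syntactically, which
-- here would mean rerunning a check or expanding cornerNumber symbolically.
everyColouringChecked : everyInjection Fin._≟_ (allFin 6) 6 [] (λ v → isPairOfMIfEdge (sharedWith (cornersOf v))) ≡ true
everyColouringChecked = refl

isPairOfMIfEdge-colouring : ∀ C → isPairOfMIfEdge (sharedWith (cornersOf (Vec.tabulate (col C)))) ≡ true
isPairOfMIfEdge-colouring C =
  everyInjection-sound Fin._≟_ (allFin 6) ∈-allFin 6 [] (λ v → isPairOfMIfEdge (sharedWith (cornersOf v)))
                       everyColouringChecked (col C) (inj C) (λ _ ())

isPairOfMIfEdge⇒∈pairsOfM : ∀ {s} → isPairOfMIfEdge s ≡ true → (length s ≡ᵇ 2) ≡ true → s ∈ pairsOfM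
isPairOfMIfEdge⇒∈pairsOfM checked edge with Equivalence.to T-∨ (Equivalence.from T-≡ checked)
... | inj₁ notEdge = contradiction (≡-trans (sym edge) (Equivalence.to T-not-≡ notEdge)) λ ()
... | inj₂ isPair  = toWitness isPair

labelsEdge⇒shared∈pairsOfM : ∀ C → labelsEdge C ≡ true → shared C ∈ pairsOfM
labelsEdge⇒shared∈pairsOfM C edge = subst (_∈ pairsOfM) (sharedWith-cornersOf C)
  (isPairOfMIfEdge⇒∈pairsOfM (isPairOfMIfEdge-colouring C)
    (subst (λ s → (length s ≡ᵇ 2) ≡ true) (sym (sharedWith-cornersOf C)) edge))

-- Connectivity

crosses : (ℕ → Bool) → List ℕ → Bool
crosses S e = any S e ∧ not (all S e)

uncrossed-pair : ∀ S {u v} → crosses S (u ∷ v ∷ []) ≡ false → S u ≡ S v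
uncrossed-pair S {u} {v} uncrossed with S u | S v
uncrossed-pair S {u} {v} _  | true  | true  = refl
uncrossed-pair S {u} {v} _  | false | false = refl
uncrossed-pair S {u} {v} () | true  | false
uncrossed-pair S {u} {v} () | false | true

isCut : List ℕ → List (List ℕ) → Bool
isCut S D = 123 ∈ᵇ S ∧ not (all (_∈ᵇ S) baCorners) ∧ all (not ∘ crosses (_∈ᵇ S)) D

isCut⁻ : ∀ S D → isCut S D ≡ true →
         T (123 ∈ᵇ S) × T (not (all (_∈ᵇ S) baCorners)) × All (λ e → crosses (_∈ᵇ S) e ≡ false) D
isCut⁻ S D cut with 123∈S , rest ← Equivalence.to (T-∧ {123 ∈ᵇ S}) (Equivalence.from T-≡ cut)
                  with notAll , uncrossed ← Equivalence.to (T-∧ {not (all (_∈ᵇ S) baCorners)}) rest =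
  123∈S , notAll , All.map (Equivalence.to T-not-≡) (all⁺ _ D uncrossed)

connected⇒¬isCut : ∀ W D → Connected W → (∀ i → labelsEdge (W i) ≡ true → shared (W i) ∈ D) →
                   ∀ S → isCut S D ≡ true → ⊥
connected⇒¬isCut W D connected edge∈D S cut = subst T (Equivalence.to T-not-≡ notAll) allIn
  where
  123∈S : T (123 ∈ᵇ S)
  123∈S = proj₁ (isCut⁻ S D cut)
  notAll : T (not (all (_∈ᵇ S) baCorners))
  notAll = proj₁ (proj₂ (isCut⁻ S D cut))
  uncrossed : All (λ e → crosses (_∈ᵇ S) e ≡ false) D
  uncrossed = proj₂ (proj₂ (isCut⁻ S D cut))
  step : ∀ {u v} → Adj W u v → u ∈ᵇ S ≡ v ∈ᵇ S
  step (i , edge , inj₁ eq) =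
    uncrossed-pair (_∈ᵇ S) (subst (λ e → crosses (_∈ᵇ S) e ≡ false) eq (lookup uncrossed (edge∈D i edge)))
  step (i , edge , inj₂ eq) =
    sym (uncrossed-pair (_∈ᵇ S) (subst (λ e → crosses (_∈ᵇ S) e ≡ false) eq (lookup uncrossed (edge∈D i edge))))
  reach : ∀ {u v} → Star (Adj W) u v → u ∈ᵇ S ≡ v ∈ᵇ S
  reach ε            = refl
  reach (adj ◅ path) = ≡-trans (step adj) (reach path)
  allIn : T (all (_∈ᵇ S) baCorners)
  allIn = all⁻ _ (All.tabulate (λ n∈ba → subst T (reach (connected 123 _ (here refl) n∈ba)) 123∈S))

grow : List (List ℕ) → List ℕ → List ℕ
grow D S = foldr extend S D
  where
  extend : List ℕ → List ℕ → List ℕ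
  extend e S′ = if any (_∈ᵇ S′) e then filterᵇ (not ∘ (_∈ᵇ S′)) e ++ S′ else S′

-- Only a candidate: isCut verifies it, so nothing about it needs proof.
componentOf123 : List (List ℕ) → List ℕ
componentOf123 D = iterate (grow D) (123 ∷ []) 7

cutOrSpanning : List (List ℕ) → Bool
cutOrSpanning D = isCut (componentOf123 D) D ∨ ((length D ≡ᵇ 7) ∧ (ByCorners.matchings (baCorners ∷ D) baCorners ≡ᵇ 8))

everySmallSubgraphChecked : everySublist 7 pairsOfM cutOrSpanning ≡ true
everySmallSubgraphChecked = refl

cut-or-spanning : ∀ {D} → D ⊑ pairsOfM → length D ≤ 7 →
                  isCut (componentOf123 D) D ≡ true ⊎ (length D ≡ 7 × ByCorners.matchings (baCorners ∷ D) baCorners ≡ 8)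
cut-or-spanning {D} D⊑ D≤7
  with Equivalence.to (T-∨ {isCut (componentOf123 D) D})
                      (Equivalence.from T-≡ (everySublist-sound 7 pairsOfM cutOrSpanning everySmallSubgraphChecked D⊑ D≤7))
... | inj₁ cut      = inj₁ (Equivalence.to T-≡ cut)
... | inj₂ spanning with len7 , eight ← Equivalence.to (T-∧ {length D ≡ᵇ 7}) spanning =
  inj₂ (≡ᵇ⇒≡ (length D) 7 len7 , ≡ᵇ⇒≡ _ 8 eight)

module EdgeCubes (W : Fin 8 → Coloring) (b : Fin 8) (ba : IsBa (W b)) (count7 : edgeCount W ≡ 7) where
  open Intersection (≡-dec _≟_)

  edgeCubes : List Coloring
  edgeCubes = tabulate (W ∘ punchIn b)

  ¬labelsEdge-b : labelsEdge (W b) ≡ false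
  ¬labelsEdge-b = IsBa⇒¬labelsEdge (W b) ba

  edgeCubes-label : All (λ C → labelsEdge C ≡ true) edgeCubes
  edgeCubes-label = All-tabulate-punchIn labelsEdge W b ¬labelsEdge-b (≡-trans (count-tabulate labelsEdge W) count7)

  edgeRows : List (List ℕ)
  edgeRows = map shared edgeCubes

  length-edgeRows : length edgeRows ≡ 7
  length-edgeRows = ≡-trans (length-map shared edgeCubes) (length-tabulate (W ∘ punchIn b))

  rows↭ : map shared (tabulate W) ↭ baCorners ∷ edgeRows
  rows↭ = subst (λ r → map shared (tabulate W) ↭ r ∷ edgeRows) (IsBa⇒shared≡baCorners (W b) ba)
                (map-tabulate-↭ shared W b)

  pairsOfG : List (List ℕ)
  pairsOfG = pairsOfM ∩ edgeRows

  pairsOfG⊆edgeRows : pairsOfG ⊆ edgeRows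
  pairsOfG⊆edgeRows = ∈-∩⁻ pairsOfM

  edgeRows⊆pairsOfG : edgeRows ⊆ pairsOfG
  edgeRows⊆pairsOfG = map-⊆ shared λ {C} C∈edgeCubes →
    ∈-∩⁺ {xs = pairsOfM} {ys = edgeRows}
         (labelsEdge⇒shared∈pairsOfM C (lookup edgeCubes-label C∈edgeCubes)) (∈-map⁺ shared C∈edgeCubes)

  pairsOfG-unique : Unique pairsOfG
  pairsOfG-unique = ∩-unique edgeRows pairsOfM-unique

  length-pairsOfG≤7 : length pairsOfG ≤ 7
  length-pairsOfG≤7 = subst (length pairsOfG ≤_) length-edgeRows (Unique-⊆⇒length≤ pairsOfG-unique pairsOfG⊆edgeRows)

  edgeRows↭pairsOfG : length pairsOfG ≡ 7 → edgeRows ↭ pairsOfG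
  edgeRows↭pairsOfG len =
    Unique-⊆-⊇⇒↭ pairsOfG-unique edgeRows⊆pairsOfG pairsOfG⊆edgeRows (≤-reflexive (≡-trans length-edgeRows (sym len)))

  edge∈pairsOfG : ∀ i → labelsEdge (W i) ≡ true → shared (W i) ∈ pairsOfG
  edge∈pairsOfG i edge = edgeRows⊆pairsOfG {shared (W i)}
    (∈-map⁺ shared {x = W i} {xs = edgeCubes} (∈-tabulate-punchIn labelsEdge W b ¬labelsEdge-b {i} edge))

  connected⇒spanning : Connected W → length pairsOfG ≡ 7 × ByCorners.matchings (baCorners ∷ pairsOfG) baCorners ≡ 8
  connected⇒spanning connected =
    [ (λ cut → ⊥-elim (connected⇒¬isCut W pairsOfG connected edge∈pairsOfG (componentOf123 pairsOfG) cut)) , id ]′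
    (cut-or-spanning {pairsOfG} (∩-⊑ pairsOfM edgeRows) length-pairsOfG≤7)

lemma11 : (W : Fin 8 → Coloring)
          → (∀ i j → i ≢ j → ¬ (W i ∼ W j))
          → (∃ λ i → IsBa (W i))
          → edgeCount W ≡ 7
          → Connected W
          → solutionNumber W ≡ 8
lemma11 W _ (b , ba) count7 connected = begin
  solutionNumber W                                        ≡⟨ solutionNumber≡matchings W ⟩
  ByCorners.matchings (map shared (tabulate W)) baCorners ≡⟨ ByCorners.matchings-↭ baCorners rows↭pairs ⟩
  ByCorners.matchings (baCorners ∷ pairsOfG) baCorners    ≡⟨ proj₂ spanning ⟩
  8                                                       ∎
  where
  open EdgeCubes W b ba count7
  open ≡-Reasoning
  spanning : length pairsOfG ≡ 7 × ByCorners.matchings (baCorners ∷ pairsOfG) baCorners ≡ 8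
  spanning = connected⇒spanning connected
  rows↭pairs : map shared (tabulate W) ↭ baCorners ∷ pairsOfG
  rows↭pairs = trans rows↭ (prep baCorners (edgeRows↭pairsOfG (proj₁ spanning)))
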